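{- Let $\mathscr K$ be an ultracontact on a non-trivial Boolean algebra $B$ and let $\mathcal G$ be a non-empty collection of grills of $B$. Then $\mathscr K^{\mathcal G}=\mathscr K\cup\{F\subseteq B: F\neq\emptyset \text{ and } F\subseteq G \text{ for some } G\in\mathcal G\}$ is an ultracontact on $B$. Moreover, $\mathscr K^{\mathcal G}$ is the smallest ultracontact on $B$ that contains $\mathscr K$ and contains every grill belonging to $\mathcal G$ as an element.
   Context: Let $B$ be a non-trivial Boolean algebra with order $\le$ and join $+$. A grill of $B$ is a non-empty set $G\subseteq B$ such that $0\notin G$; if $a\in G$ and $a\le b$ then $b\in G$; and if $a+b\in G$ then $a\in G$ or $b\in G$. For $F,G\subseteq B$ put $F+G=\{f+g: f\in F,\ g\in G\}$, and write $F\preceq G$ iff for every $g\in G$ there is $f\in F$ with $f\le g$. An ultracontact on $B$ is a family $\mathscr K\subseteq 2^B$ such that for all $F,G\subseteq B$: (K0) $\emptyset\notin\mathscr K$; (K1) if $0\in F$ then $F\notin\mathscr K$; (K2) if $x\neq 0$ then $\{x\}\in\mathscr K$; (K3) if $F\preceq G$, $G\neq\emptyset$ and $F\in\mathscr K$, then $G\in\mathscr K$; (K4) if $F+G\in\mathscr K$ then $F\in\mathscr K$ or $G\in\mathscr K$. -}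

module Defs where

open import Level using (Level; _⊔_; suc; Lift)
open import Algebra.Lattice.Bundles using (BooleanAlgebra)
open import Data.Product using (Σ; ∃; _×_)
open import Data.Sum using (_⊎_)
open import Relation.Nullary using (¬_)
open import Relation.Unary using (Pred; Satisfiable; Empty; _⊆_)

module _ {c ℓ : Level} (B : BooleanAlgebra c ℓ) where
  open BooleanAlgebra B renaming (⊥ to 𝟘; ⊤ to 𝟙; ¬_ to compl)

  -- subsets of B (elements of 2^B); level c ⊔ ℓ so that F + G is again one
  Sub : Set (suc (c ⊔ ℓ))
  Sub = Pred Carrier (c ⊔ ℓ)

  NonTrivial : Set ℓ
  NonTrivial = ¬ (𝟘 ≈ 𝟙)

  -- the order of B: a ≤ b iff a + b = b  (+ is the join ∨)
  _≤B_ : Carrier → Carrier → Set ℓ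
  a ≤B b = (a ∨ b) ≈ b

  ｛_｝ : Carrier → Sub
  ｛ x ｝ y = Lift c (y ≈ x)

  _⊕_ : Sub → Sub → Sub
  (F ⊕ G) x = ∃ λ f → ∃ λ g → F f × G g × (x ≈ (f ∨ g))

  _≼_ : Sub → Sub → Set (c ⊔ ℓ)
  F ≼ G = ∀ g → G g → ∃ λ f → F f × (f ≤B g)

  record IsGrill (G : Sub) : Set (c ⊔ ℓ) where
    field
      nonempty : Satisfiable G
      no-zero  : ¬ G 𝟘
      up-closed : ∀ a b → G a → a ≤B b → G b
      prime    : ∀ a b → G (a ∨ b) → G a ⊎ G b

  record IsUltracontact {q : Level} (K : Pred Sub q) : Set (suc (c ⊔ ℓ) ⊔ q) where
    field
      K0 : ∀ F → Empty F → ¬ K F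
      K1 : ∀ F → F 𝟘 → ¬ K F
      K2 : ∀ x → ¬ (x ≈ 𝟘) → K ｛ x ｝
      K3 : ∀ F G → F ≼ G → Satisfiable G → K F → K G
      K4 : ∀ F G → K (F ⊕ G) → K F ⊎ K G

  extend : {q r : Level} → Pred Sub q → Pred Sub r → Pred Sub (suc (c ⊔ ℓ) ⊔ q ⊔ r)
  extend K 𝒢 F = K F ⊎ (Satisfiable F × ∃ λ G → 𝒢 G × F ⊆ G)

{-# OPTIONS --safe #-}
-- A member of 𝒦^𝒢 outside 𝒦 is a non-empty subset F of some grill H. Such families satisfy K3
-- because H is an upset, and K4 because primality of H makes F ⊕ G ⊆ H force F ⊆ H or G ⊆ H
-- (classically). For minimality, H ≼ F whenever F ⊆ H, so K3 moves H ∈ L down to F ∈ L.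
module Submission where

open import Defs hiding (_≼_; _⊕_)
import Defs
open import Level using (Level; _⊔_)
open import Algebra.Lattice.Bundles using (BooleanAlgebra)
open import Data.Product using (_×_; _,_)
open import Data.Sum using (_⊎_; inj₁; inj₂; [_,_]′)
import Data.Sum as Sum
open import Function using (id)
open import Relation.Nullary using (yes; no; contradiction)
open import Relation.Nullary.Decidable using (decidable-stable)
open import Relation.Unary using (Pred; Satisfiable; _⊆_)
open import Axiom.ExcludedMiddle using (ExcludedMiddle)

module _ {c ℓ : Level} (B : BooleanAlgebra c ℓ) where
  open BooleanAlgebra B using (_∨_; refl)
  open import Algebra.Lattice.Properties.BooleanAlgebra B using (∨-idem)

  private
    _≼_ : Sub B → Sub B → Set (c ⊔ ℓ)
    _≼_ = Defs._≼_ B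

    _⊕_ : Sub B → Sub B → Sub B
    _⊕_ = Defs._⊕_ B

  ⊆⇒≽ : {F G : Sub B} → F ⊆ G → G ≼ F
  ⊆⇒≽ F⊆G f Ff = f , F⊆G Ff , ∨-idem f

  ultracontact-⊆-closed : {q : Level} {L : Pred (Sub B) q} → IsUltracontact B L →
                          {F G : Sub B} → L G → F ⊆ G → Satisfiable F → L F
  ultracontact-⊆-closed UL {F} {G} LG F⊆G ∃F = IsUltracontact.K3 UL G F (⊆⇒≽ F⊆G) ∃F LG

  module _ {H : Sub B} (H-grill : IsGrill B H) where
    open IsGrill H-grill

    ⊆-grill-≼ : {F G : Sub B} → F ⊆ H → F ≼ G → G ⊆ H
    ⊆-grill-≼ F⊆H F≼G {g} Gg with F≼G g Gg
    ... | f , Ff , f≤g = up-closed f g (F⊆H Ff) f≤g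

    -- A single g ∈ G outside H would put every f ∈ F into H, by primality of H at f ∨ g.
    ⊕-⊆-grill : ExcludedMiddle (c ⊔ ℓ) → {F G : Sub B} → F ⊕ G ⊆ H → F ⊆ H ⊎ G ⊆ H
    ⊕-⊆-grill em {F} F⊕G⊆H with em {F ⊆ H}
    ... | yes F⊆H = inj₁ F⊆H
    ... | no F⊈H = inj₂ λ {g} Gg → decidable-stable em λ g∉H → F⊈H λ {f} Ff →
      [ id , (λ Hg → contradiction Hg g∉H) ]′ (prime f g (F⊕G⊆H (f , g , Ff , Gg , refl)))

  extend-least : {q r s : Level} {K : Pred (Sub B) q} {𝒢 : Pred (Sub B) r} {L : Pred (Sub B) s} →
                 IsUltracontact B L → K ⊆ L → 𝒢 ⊆ L → extend B K 𝒢 ⊆ L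
  extend-least UL K⊆L 𝒢⊆L (inj₁ KF)                  = K⊆L KF
  extend-least UL K⊆L 𝒢⊆L (inj₂ (∃F , H , 𝒢H , F⊆H)) = ultracontact-⊆-closed UL (𝒢⊆L 𝒢H) F⊆H ∃F

  module _ {r : Level} {𝒢 : Pred (Sub B) r} (𝒢-grills : ∀ G → 𝒢 G → IsGrill B G) where

    grills⊆extend : {q : Level} {K : Pred (Sub B) q} → 𝒢 ⊆ extend B K 𝒢
    grills⊆extend {x = G} 𝒢G = inj₂ (IsGrill.nonempty (𝒢-grills G 𝒢G) , G , 𝒢G , id)

    extend-isUltracontact : ExcludedMiddle (c ⊔ ℓ) → {q : Level} {K : Pred (Sub B) q} →
                            IsUltracontact B K → IsUltracontact B (extend B K 𝒢)
    extend-isUltracontact em {K = K} UK = record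
      { K0 = λ where
          F ∅F (inj₁ KF)                 → UK.K0 F ∅F KF
          F ∅F (inj₂ ((x , Fx) , _))     → ∅F x Fx
      ; K1 = λ where
          F F𝟘 (inj₁ KF)                 → UK.K1 F F𝟘 KF
          F F𝟘 (inj₂ (_ , H , 𝒢H , F⊆H)) → IsGrill.no-zero (𝒢-grills H 𝒢H) (F⊆H F𝟘)
      ; K2 = λ x x≉𝟘 → inj₁ (UK.K2 x x≉𝟘)
      ; K3 = λ where
          F G F≼G ∃G (inj₁ KF)                 → inj₁ (UK.K3 F G F≼G ∃G KF)
          F G F≼G ∃G (inj₂ (_ , H , 𝒢H , F⊆H)) →
            inj₂ (∃G , H , 𝒢H , ⊆-grill-≼ (𝒢-grills H 𝒢H) F⊆H F≼G)
      ; K4 = λ where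
          F G (inj₁ KF⊕G) → Sum.map inj₁ inj₁ (UK.K4 F G KF⊕G)
          F G (inj₂ ((_ , f , g , Ff , Gg , _) , H , 𝒢H , F⊕G⊆H)) → split-⊕-below-grill Ff Gg 𝒢H F⊕G⊆H
      }
      where
      module UK = IsUltracontact UK

      split-⊕-below-grill : ∀ {F G f g H} → F f → G g → 𝒢 H → F ⊕ G ⊆ H →
                            extend B K 𝒢 F ⊎ extend B K 𝒢 G
      split-⊕-below-grill {f = f} {g} {H} Ff Gg 𝒢H F⊕G⊆H with ⊕-⊆-grill (𝒢-grills H 𝒢H) em F⊕G⊆H
      ... | inj₁ F⊆H = inj₁ (inj₂ ((f , Ff) , H , 𝒢H , F⊆H))
      ... | inj₂ G⊆H = inj₂ (inj₂ ((g , Gg) , H , 𝒢H , G⊆H))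

theorem5p2 : {c ℓ q r s : Level} → ExcludedMiddle (c ⊔ ℓ) → (B : BooleanAlgebra c ℓ) → NonTrivial B
    → (K : Pred (Sub B) q) → IsUltracontact B K
    → (𝒢 : Pred (Sub B) r) → Satisfiable 𝒢 → (∀ G → 𝒢 G → IsGrill B G)
    → IsUltracontact B (extend B K 𝒢)
      × (K ⊆ extend B K 𝒢)
      × (𝒢 ⊆ extend B K 𝒢)
      × (∀ (L : Pred (Sub B) s) → IsUltracontact B L → K ⊆ L → 𝒢 ⊆ L → extend B K 𝒢 ⊆ L)
theorem5p2 em B _ K UK 𝒢 _ 𝒢-grills =
    extend-isUltracontact B 𝒢-grills em UK
  , inj₁
  , grills⊆extend B 𝒢-grills {K = K}
  , λ L UL → extend-least B {K = K} {𝒢} {L} UL
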